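{- Let $s$ and $n$ be integers with $2\le s\le n$. Then $$K_sK_{s-1}\cdots K_1=\mathrm{Id}-\sum_{j=1}^{s}\mathbf{e}_j\mathbf{e}_j^T-\sum_{j=2}^{s}\mathbf{e}_j\mathbf{e}_{j-1}^T+\mathbf{e}_1\mathbf{r}_1$$ and $$K_{n-s+1}\cdots K_{n-1}K_n=\mathrm{Id}-\sum_{j=1}^{s}\mathbf{e}_{n-j+1}\mathbf{e}_{n-j+1}^T-\sum_{j=2}^{s}\mathbf{e}_{n-j+1}\mathbf{e}_{n-j+2}^T+\mathbf{e}_n\mathbf{r}_n.$$
   Context: For a positive integer $n$: - $\mathbf{e}_j$ is the $j$-th standard basis column vector of $\mathbb{Z}^n$; - $\mathbf{r}_j=\big((-1)^j,(-1)^{j+1},\dots,(-1)^{j+n-1}\big)$ is a row vector; - $K_j=\mathrm{Id}-\mathbf{e}_j\mathbf{e}_j^T+\mathbf{e}_j\mathbf{r}_j$ is the $n\times n$ identity matrix with row $j$ replaced by $\mathbf{r}_j$. -}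

module Defs where

open import Data.Nat as ℕ using (ℕ; zero; suc; _∸_; _≡ᵇ_)
open import Data.Bool using (if_then_else_)
open import Data.Fin using (Fin; toℕ) renaming (zero to fzero; suc to fsuc)
open import Relation.Binary.PropositionalEquality using (_≡_)
open import Data.Integer using (ℤ; 0ℤ; 1ℤ; -1ℤ; _+_; _-_; _*_; _^_)

-- n × n integer matrices, entries indexed by Fin n (row, column).
-- Paper indices are 1-based: the entry at (i , k) has paper-index (toℕ i + 1 , toℕ k + 1).
Matrix : ℕ → Set
Matrix n = Fin n → Fin n → ℤ

pos : ∀ {n} → Fin n → ℕ
pos i = suc (toℕ i)

δ : ℕ → ℕ → ℤ
δ a b = if a ≡ᵇ b then 1ℤ else 0ℤ

Id : (n : ℕ) → Matrix n
Id n i k = δ (pos i) (pos k)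

e : (n : ℕ) → ℕ → Fin n → ℤ
e n j i = δ (pos i) j

-- row vector r_j = ((-1)^j, (-1)^(j+1), ..., (-1)^(j+n-1)); k-th entry (1-based k) is (-1)^(j+k-1)
r : (n : ℕ) → ℕ → Fin n → ℤ
r n j k = -1ℤ ^ (j ℕ.+ toℕ k)

outer : ∀ {n} → (Fin n → ℤ) → (Fin n → ℤ) → Matrix n
outer u v i k = u i * v k

_⊕_ : ∀ {n} → Matrix n → Matrix n → Matrix n
(A ⊕ B) i k = A i k + B i k

_⊖_ : ∀ {n} → Matrix n → Matrix n → Matrix n
(A ⊖ B) i k = A i k - B i k

Zero : (n : ℕ) → Matrix n
Zero n i k = 0ℤ

sumFin : (n : ℕ) → (Fin n → ℤ) → ℤ
sumFin zero f = 0ℤ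
sumFin (suc n) f = f fzero + sumFin n (λ i → f (fsuc i))

_⊗_ : ∀ {n} → Matrix n → Matrix n → Matrix n
_⊗_ {n} A B i k = sumFin n (λ m → A i m * B m k)

-- ΣM a b f = f a + f (a+1) + ... + f b  (zero matrix if b < a)
ΣM : (n : ℕ) → ℕ → ℕ → (ℕ → Matrix n) → Matrix n
ΣM n a b f = go (suc b ∸ a)
  where
  go : ℕ → Matrix n
  go zero = Zero n
  go (suc t) = go t ⊕ f (a ℕ.+ t)

K : (n : ℕ) → ℕ → Matrix n
K n j = (Id n ⊖ outer (e n j) (e n j)) ⊕ outer (e n j) (r n j)

prodDown : (n : ℕ) → ℕ → Matrix n
prodDown n zero = Id n
prodDown n (suc s) = K n (suc s) ⊗ prodDown n s

-- K_{n-s+1} ⋯ K_{n-1} K_n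
prodUp : (n : ℕ) → ℕ → Matrix n
prodUp n zero = Id n
prodUp n (suc t) = K n (n ∸ t) ⊗ prodUp n t

_≐_ : ∀ {n} → Matrix n → Matrix n → Set
A ≐ B = ∀ i k → A i k ≡ B i k

-- Left multiplication by K_j changes only row j, which becomes r_j times the matrix.  Since
-- r_{j±1} = -r_j and the j-th entry of r_{j±1} is 1, we get r_{j±1} K_j = -e_jᵀ; hence the row that
-- K_{j±1} creates in K_{j±1} K_j M is minus row j of M, and that row is still e_jᵀ.  So K_s ⋯ K_1 has
-- rows r_1, -e_1ᵀ, …, -e_{s-1}ᵀ followed by identity rows, K_{n-s+1} ⋯ K_n has identity rows followed
-- by -e_{n-s+2}ᵀ, …, -e_nᵀ, r_n.  In every row of the right-hand sides each sum contributes at most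
-- one term, and this gives the same rows.

module Submission where

open import Data.Fin using (Fin; toℕ; fromℕ<) renaming (zero to fzero; suc to fsuc)
open import Data.Fin.Properties using (toℕ<n; toℕ-fromℕ<)
open import Data.Nat as ℕ using (ℕ; zero; suc; _∸_; _≤_; _<_; z≤n; s≤s)
import Data.Nat.Properties as ℕ
open import Data.Product using (_×_; _,_)
open import Function using (_∘_)
open import Relation.Binary.PropositionalEquality

open import Defs

-- ℤ's _+_ is opened only inside this module, so that _+_ in the statement below is ℕ's.
module Rows where

  open import Data.Integer using (ℤ; 0ℤ; 1ℤ; -1ℤ; _+_; _-_; _*_; -_; _^_)
  import Data.Integer.Properties as ℤ
  open import Algebra.Properties.Semiring.Sum ℤ.+-*-semiring
    using (sum; sum-syntax; sum-cong-≗; sum-replicate-zero; ∑-distrib-+; ∑-comm; *-distribˡ-sum; *-distribʳ-sum)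
  open import Data.Integer.Tactic.RingSolver using (solve-∀)
  open import Data.Sum using (inj₁; inj₂)
  open import Relation.Nullary using (yes; no; contradiction)

  m∸n≡1+[m∸[1+n]] : ∀ m n → 0 < m ∸ suc n → m ∸ n ≡ suc (m ∸ suc n)
  m∸n≡1+[m∸[1+n]] (suc m) zero    _ = refl
  m∸n≡1+[m∸[1+n]] (suc m) (suc n) h = m∸n≡1+[m∸[1+n]] m n h

  pred[m]<n∧n≢m⇒m<n : ∀ {m n} → ℕ.pred m < n → n ≢ m → m < n
  pred[m]<n∧n≢m⇒m<n {zero}  h _   = h
  pred[m]<n∧n≢m⇒m<n {suc m} h n≢m = ℕ.≤∧≢⇒< h (≢-sym n≢m)

  δ-refl : ∀ a → δ a a ≡ 1ℤ
  δ-refl zero    = refl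
  δ-refl (suc a) = δ-refl a

  δ-≢ : ∀ {a b} → a ≢ b → δ a b ≡ 0ℤ
  δ-≢ {zero}  {zero}  a≢b = contradiction refl a≢b
  δ-≢ {zero}  {suc b} _   = refl
  δ-≢ {suc a} {zero}  _   = refl
  δ-≢ {suc a} {suc b} a≢b = δ-≢ (a≢b ∘ cong suc)

  δ-sym : ∀ a b → δ a b ≡ δ b a
  δ-sym zero    zero    = refl
  δ-sym zero    (suc b) = refl
  δ-sym (suc a) zero    = refl
  δ-sym (suc a) (suc b) = δ-sym a b

  Id-row : ∀ n (i : Fin n) → Id n i ≗ e n (pos i)
  Id-row n i k = δ-sym (pos i) (pos k)

  e-beyond : ∀ n j → n < j → e n j ≗ λ _ → 0ℤ
  e-beyond n j n<j k = δ-≢ (ℕ.<⇒≢ (ℕ.≤-<-trans (toℕ<n k) n<j))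

  infixl 7 _⊙_

  _⊙_ : ∀ {n} → (Fin n → ℤ) → Matrix n → Fin n → ℤ
  _⊙_ {n} v M k = ∑[ m < n ] (v m * M m k)

  ⊗-row : ∀ {n} (A M : Matrix n) i → (A ⊗ M) i ≗ A i ⊙ M
  ⊗-row {n} A M i k = sumFin≡sum n (λ m → A i m * M m k)
    where
    sumFin≡sum : ∀ n f → sumFin n f ≡ sum f
    sumFin≡sum zero    f = refl
    sumFin≡sum (suc n) f = cong (f fzero +_) (sumFin≡sum n (f ∘ fsuc))

  ⊙-congˡ : ∀ {n} {v w : Fin n → ℤ} (M : Matrix n) → v ≗ w → v ⊙ M ≗ w ⊙ M
  ⊙-congˡ M v≗w k = sum-cong-≗ (λ m → cong (_* M m k) (v≗w m))

  sum-δ : ∀ {n} (c : Fin n) (f : Fin n → ℤ) → ∑[ m < n ] (δ (pos m) (pos c) * f m) ≡ f c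
  sum-δ {suc n} fzero    f = begin
    1ℤ * f fzero + ∑[ m < n ] 0ℤ  ≡⟨ cong₂ _+_ (ℤ.*-identityˡ (f fzero)) (sum-replicate-zero n) ⟩
    f fzero + 0ℤ                   ≡⟨ ℤ.+-identityʳ (f fzero) ⟩
    f fzero                        ∎
    where open ≡-Reasoning
  sum-δ {suc n} (fsuc c) f = trans (ℤ.+-identityˡ _) (sum-δ c (f ∘ fsuc))

  e-⊙ : ∀ {n} (c : Fin n) (M : Matrix n) → e n (pos c) ⊙ M ≗ M c
  e-⊙ c M k = sum-δ c (λ m → M m k)

  ⊙-Id : ∀ {n} (v : Fin n → ℤ) → v ⊙ Id n ≗ v
  ⊙-Id v k = trans (sum-cong-≗ (λ m → ℤ.*-comm (v m) _)) (sum-δ k v)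

  ⊙-assoc : ∀ {n} (v : Fin n → ℤ) (A M : Matrix n) → v ⊙ (A ⊗ M) ≗ (v ⊙ A) ⊙ M
  ⊙-assoc {n} v A M k = begin
    ∑[ m < n ] (v m * (A ⊗ M) m k)
      ≡⟨ sum-cong-≗ (λ m → cong (v m *_) (⊗-row A M m k)) ⟩
    ∑[ m < n ] (v m * ∑[ l < n ] (A m l * M l k))
      ≡⟨ sum-cong-≗ (λ m → *-distribˡ-sum (v m) (λ l → A m l * M l k)) ⟩
    ∑[ m < n ] ∑[ l < n ] (v m * (A m l * M l k))
      ≡⟨ ∑-comm (λ m l → v m * (A m l * M l k)) ⟩
    ∑[ l < n ] ∑[ m < n ] (v m * (A m l * M l k))
      ≡⟨ sum-cong-≗ (λ l → sum-cong-≗ (λ m → sym (ℤ.*-assoc (v m) (A m l) (M l k)))) ⟩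
    ∑[ l < n ] ∑[ m < n ] (v m * A m l * M l k)
      ≡⟨ sum-cong-≗ (λ l → sym (*-distribʳ-sum (M l k) (λ m → v m * A m l))) ⟩
    ∑[ l < n ] ((v ⊙ A) l * M l k)
      ∎
    where open ≡-Reasoning

  neg-⊙ : ∀ {n} (v : Fin n → ℤ) (M : Matrix n) → (-_ ∘ v) ⊙ M ≗ -_ ∘ (v ⊙ M)
  neg-⊙ {n} v M k = begin
    ∑[ m < n ] (- v m * M m k)
      ≡⟨ sum-cong-≗ (λ m → sym (trans (ℤ.-1*i≡-i _) (ℤ.neg-distribˡ-* (v m) _))) ⟩
    ∑[ m < n ] (-1ℤ * (v m * M m k))
      ≡⟨ *-distribˡ-sum -1ℤ (λ m → v m * M m k) ⟨
    -1ℤ * (v ⊙ M) k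
      ≡⟨ ℤ.-1*i≡-i _ ⟩
    - (v ⊙ M) k
      ∎
    where open ≡-Reasoning

  K-row : ∀ n j (i : Fin n) → K n j i ≗ λ k → Id n i k + δ (pos i) j * (r n j k - e n j k)
  K-row n j i k = rearrange (δ (pos i) (pos k)) (δ (pos i) j) (r n j k) (e n j k)
    where
    rearrange : ∀ a b x y → (a - b * y) + b * x ≡ a + b * (x - y)
    rearrange = solve-∀

  K-row-≢ : ∀ n j (i : Fin n) → pos i ≢ j → K n j i ≗ e n (pos i)
  K-row-≢ n j i i≢j k = begin
    K n j i k                                     ≡⟨ K-row n j i k ⟩
    Id n i k + δ (pos i) j * (r n j k - e n j k)  ≡⟨ cong (λ d → Id n i k + d * (r n j k - e n j k)) (δ-≢ i≢j) ⟩
    Id n i k + 0ℤ                                 ≡⟨ ℤ.+-identityʳ _ ⟩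
    Id n i k                                      ≡⟨ Id-row n i k ⟩
    e n (pos i) k                                 ∎
    where open ≡-Reasoning

  K-row-≡ : ∀ n (i : Fin n) → K n (pos i) i ≗ r n (pos i)
  K-row-≡ n i k = begin
    K n (pos i) i k                                ≡⟨ K-row n (pos i) i k ⟩
    Id n i k + δ p p * (x - e n p k)               ≡⟨ cong₂ (λ d y → Id n i k + d * (x - y)) (δ-refl p) (δ-sym (pos k) p) ⟩
    Id n i k + 1ℤ * (x - Id n i k)                 ≡⟨ cancel (Id n i k) x ⟩
    x                                              ∎
    where
    open ≡-Reasoning
    p : ℕ
    p = pos i
    x : ℤ
    x = r n p k
    cancel : ∀ a x → a + 1ℤ * (x - a) ≡ x
    cancel = solve-∀

  K-⊗-row-≢ : ∀ n j (M : Matrix n) (i : Fin n) → pos i ≢ j → (K n j ⊗ M) i ≗ M i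
  K-⊗-row-≢ n j M i i≢j k = begin
    (K n j ⊗ M) i k      ≡⟨ ⊗-row (K n j) M i k ⟩
    (K n j i ⊙ M) k      ≡⟨ ⊙-congˡ M (K-row-≢ n j i i≢j) k ⟩
    (e n (pos i) ⊙ M) k  ≡⟨ e-⊙ i M k ⟩
    M i k                ∎
    where open ≡-Reasoning

  K-⊗-row-≡ : ∀ n j (M : Matrix n) (i : Fin n) → pos i ≡ j → (K n j ⊗ M) i ≗ r n j ⊙ M
  K-⊗-row-≡ n _ M i refl k = trans (⊗-row (K n (pos i)) M i k) (⊙-congˡ M (K-row-≡ n i) k)

  ⊙-K : ∀ n (v : Fin n → ℤ) (c : Fin n) →
        v ⊙ K n (pos c) ≗ λ k → v k + v c * (r n (pos c) k - e n (pos c) k)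
  ⊙-K n v c k = begin
    ∑[ m < n ] (v m * K n j m k)
      ≡⟨ sum-cong-≗ (λ m → cong (v m *_) (K-row n j m k)) ⟩
    ∑[ m < n ] (v m * (Id n m k + δ (pos m) j * w))
      ≡⟨ sum-cong-≗ (λ m → expand (v m) (Id n m k) (δ (pos m) j) w) ⟩
    ∑[ m < n ] (v m * Id n m k + δ (pos m) j * v m * w)
      ≡⟨ ∑-distrib-+ (λ m → v m * Id n m k) (λ m → δ (pos m) j * v m * w) ⟩
    (v ⊙ Id n) k + ∑[ m < n ] (δ (pos m) j * v m * w)
      ≡⟨ cong₂ _+_ (⊙-Id v k) (sym (*-distribʳ-sum w (λ m → δ (pos m) j * v m))) ⟩
    v k + ∑[ m < n ] (δ (pos m) j * v m) * w
      ≡⟨ cong (λ x → v k + x * w) (sum-δ c v) ⟩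
    v k + v c * w
      ∎
    where
    open ≡-Reasoning
    j : ℕ
    j = pos c
    w : ℤ
    w = r n j k - e n j k
    expand : ∀ x a d w → x * (a + d * w) ≡ x * a + d * x * w
    expand = solve-∀

  r-suc : ∀ n j (k : Fin n) → r n (suc j) k ≡ - r n j k
  r-suc n j k = ℤ.-1*i≡-i (r n j k)

  r-pred : ∀ n j (k : Fin n) → r n j k ≡ - r n (suc j) k
  r-pred n j k = sym (trans (cong -_ (r-suc n j k)) (ℤ.neg-involutive (r n j k)))

  -1^-even : ∀ m → -1ℤ ^ (m ℕ.+ m) ≡ 1ℤ
  -1^-even zero = refl
  -1^-even (suc m) rewrite ℕ.+-suc m m | -1^-even m = refl

  r-diagonal : ∀ n (c : Fin n) → r n (pos c) c ≡ -1ℤ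
  r-diagonal n c = cong (-1ℤ *_) (-1^-even (toℕ c))

  neg-r-⊙-K : ∀ n (v : Fin n → ℤ) (c : Fin n) → (∀ k → v k ≡ - r n (pos c) k) →
              v ⊙ K n (pos c) ≗ -_ ∘ e n (pos c)
  neg-r-⊙-K n v c v≡-r k = begin
    (v ⊙ K n (pos c)) k  ≡⟨ ⊙-K n v c k ⟩
    v k + v c * (x - y)  ≡⟨ cong₂ (λ a b → a + b * (x - y)) (v≡-r k) (trans (v≡-r c) (cong -_ (r-diagonal n c))) ⟩
    - x + 1ℤ * (x - y)   ≡⟨ cancel x y ⟩
    - y                  ∎
    where
    open ≡-Reasoning
    x y : ℤ
    x = r n (pos c) k
    y = e n (pos c) k
    cancel : ∀ x y → - x + 1ℤ * (x - y) ≡ - y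
    cancel = solve-∀

  K-⊗-K-⊗-row-≡ : ∀ n j j′ (M : Matrix n) (i c : Fin n) → pos i ≡ j → pos c ≡ j′ →
                  (∀ k → r n j k ≡ - r n j′ k) → (K n j ⊗ (K n j′ ⊗ M)) i ≗ -_ ∘ M c
  K-⊗-K-⊗-row-≡ n _ _ M i c refl refl r≡-r k = begin
    (K n (pos i) ⊗ (K n (pos c) ⊗ M)) i k  ≡⟨ K-⊗-row-≡ n (pos i) (K n (pos c) ⊗ M) i refl k ⟩
    (r n (pos i) ⊙ (K n (pos c) ⊗ M)) k    ≡⟨ ⊙-assoc (r n (pos i)) (K n (pos c)) M k ⟩
    (r n (pos i) ⊙ K n (pos c) ⊙ M) k      ≡⟨ ⊙-congˡ M (neg-r-⊙-K n (r n (pos i)) c r≡-r) k ⟩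
    ((-_ ∘ e n (pos c)) ⊙ M) k             ≡⟨ neg-⊙ (e n (pos c)) M k ⟩
    - (e n (pos c) ⊙ M) k                  ≡⟨ cong -_ (e-⊙ c M k) ⟩
    - M c k                                ∎
    where open ≡-Reasoning

  record DownShape (n s : ℕ) (M : Matrix n) : Set where
    field
      first-row   : ∀ i → pos i ≡ 1 → M i ≗ r n 1
      middle-rows : ∀ i → 2 ≤ pos i → pos i ≤ s → M i ≗ -_ ∘ e n (pos i ∸ 1)
      lower-rows  : ∀ i → s < pos i → M i ≗ Id n i

  DownShape-unique : ∀ {n s} {A B : Matrix n} → DownShape n s A → DownShape n s B → A ≐ B
  DownShape-unique {s = s} {A} {B} A-shape B-shape = rows
    where
    module A = DownShape A-shape
    module B = DownShape B-shape
    rows : A ≐ B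
    rows fzero    k = trans (A.first-row fzero refl k) (sym (B.first-row fzero refl k))
    rows (fsuc i) k with pos (fsuc i) ℕ.≤? s
    ... | yes i≤s = trans (A.middle-rows (fsuc i) (s≤s (s≤s z≤n)) i≤s k)
                          (sym (B.middle-rows (fsuc i) (s≤s (s≤s z≤n)) i≤s k))
    ... | no  i≰s = trans (A.lower-rows (fsuc i) (ℕ.≰⇒> i≰s) k) (sym (B.lower-rows (fsuc i) (ℕ.≰⇒> i≰s) k))

  prodDown-lower : ∀ n t (i : Fin n) → t < pos i → prodDown n t i ≗ Id n i
  prodDown-lower n zero    i _   k = refl
  prodDown-lower n (suc t) i t<i k = trans (K-⊗-row-≢ n (suc t) (prodDown n t) i (ℕ.>⇒≢ t<i) k)
                                           (prodDown-lower n t i (ℕ.<-trans (ℕ.n<1+n t) t<i) k)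

  prodDown-shape-suc : ∀ n t → suc (suc t) ≤ n → DownShape n (suc t) (prodDown n (suc t)) →
                       DownShape n (suc (suc t)) (prodDown n (suc (suc t)))
  prodDown-shape-suc n t 2+t≤n shape = record
    { first-row   = λ i i≡1 k → trans (K-⊗-row-≢ n (suc (suc t)) D i (λ i≡2+t → 1≢2+t (trans (sym i≡1) i≡2+t)) k)
                                      (first-row i i≡1 k)
    ; middle-rows = middle
    ; lower-rows  = prodDown-lower n (suc (suc t))
    }
    where
    open DownShape shape
    D : Matrix n
    D = prodDown n (suc t)
    1≢2+t : 1 ≢ suc (suc t)
    1≢2+t ()
    middle : ∀ i → 2 ≤ pos i → pos i ≤ suc (suc t) → (K n (suc (suc t)) ⊗ D) i ≗ -_ ∘ e n (pos i ∸ 1)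
    middle i 2≤i i≤2+t with pos i ℕ.≟ suc (suc t)
    ... | no  i≢2+t = λ k → trans (K-⊗-row-≢ n (suc (suc t)) D i i≢2+t k)
                                  (middle-rows i 2≤i (ℕ.≤-pred (ℕ.≤∧≢⇒< i≤2+t i≢2+t)) k)
    ... | yes i≡2+t = λ k → begin
        (K n (suc (suc t)) ⊗ D) i k  ≡⟨ K-⊗-K-⊗-row-≡ n _ _ (prodDown n t) i c i≡2+t c≡1+t (r-suc n (suc t)) k ⟩
        - prodDown n t c k           ≡⟨ cong -_ (prodDown-lower n t c (ℕ.≤-reflexive (sym c≡1+t)) k) ⟩
        - Id n c k                   ≡⟨ cong -_ (Id-row n c k) ⟩
        - e n (pos c) k              ≡⟨ cong (λ j → - e n j k) (trans c≡1+t (cong (_∸ 1) (sym i≡2+t))) ⟩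
        - e n (pos i ∸ 1) k          ∎
      where
      open ≡-Reasoning
      c : Fin n
      c = fromℕ< (ℕ.<-trans (ℕ.n<1+n t) 2+t≤n)
      c≡1+t : pos c ≡ suc t
      c≡1+t = cong suc (toℕ-fromℕ< _)

  prodDown-shape : ∀ n s → 1 ≤ s → s ≤ n → DownShape n s (prodDown n s)
  prodDown-shape n (suc zero) _ _ = record
    { first-row   = λ i i≡1 k → trans (K-⊗-row-≡ n 1 (Id n) i i≡1 k) (⊙-Id (r n 1) k)
    ; middle-rows = λ i 2≤i i≤1 → contradiction (ℕ.≤-trans 2≤i i≤1) (λ { (s≤s ()) })
    ; lower-rows  = prodDown-lower n 1
    }
  prodDown-shape n (suc (suc t)) _ 2+t≤n =
    prodDown-shape-suc n t 2+t≤n (prodDown-shape n (suc t) (s≤s z≤n) (ℕ.<⇒≤ 2+t≤n))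

  record UpShape (n s : ℕ) (M : Matrix n) : Set where
    field
      upper-rows  : ∀ i → pos i ≤ n ∸ s → M i ≗ Id n i
      middle-rows : ∀ i → n ∸ s < pos i → pos i < n → M i ≗ -_ ∘ e n (suc (pos i))
      last-row    : ∀ i → pos i ≡ n → M i ≗ r n n

  UpShape-unique : ∀ {n s} {A B : Matrix n} → UpShape n s A → UpShape n s B → A ≐ B
  UpShape-unique {n} {s} {A} {B} A-shape B-shape = rows
    where
    module A = UpShape A-shape
    module B = UpShape B-shape
    rows : A ≐ B
    rows i k with pos i ℕ.≤? n ∸ s
    ... | yes i≤n∸s = trans (A.upper-rows i i≤n∸s k) (sym (B.upper-rows i i≤n∸s k))
    ... | no  i≰n∸s with ℕ.m≤n⇒m<n∨m≡n (toℕ<n i)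
    ...   | inj₁ i<n = trans (A.middle-rows i (ℕ.≰⇒> i≰n∸s) i<n k)
                             (sym (B.middle-rows i (ℕ.≰⇒> i≰n∸s) i<n k))
    ...   | inj₂ i≡n = trans (A.last-row i i≡n k) (sym (B.last-row i i≡n k))

  prodUp-upper : ∀ n t (i : Fin n) → pos i ≤ n ∸ t → prodUp n t i ≗ Id n i
  prodUp-upper n zero    i _         k = refl
  prodUp-upper n (suc t) i i≤n∸1+t k = trans (K-⊗-row-≢ n (n ∸ t) (prodUp n t) i i≢n∸t k)
                                             (prodUp-upper n t i i≤n∸t k)
    where
    i≤n∸t : pos i ≤ n ∸ t
    i≤n∸t = ℕ.≤-trans i≤n∸1+t (ℕ.∸-monoʳ-≤ n (ℕ.n≤1+n t))
    n∸t≡1+[n∸1+t] : n ∸ t ≡ suc (n ∸ suc t)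
    n∸t≡1+[n∸1+t] = m∸n≡1+[m∸[1+n]] n t (ℕ.≤-trans (s≤s z≤n) i≤n∸1+t)
    i≢n∸t : pos i ≢ n ∸ t
    i≢n∸t i≡n∸t = ℕ.<-irrefl refl (subst (_≤ n ∸ suc t) (trans i≡n∸t n∸t≡1+[n∸1+t]) i≤n∸1+t)

  prodUp-shape-suc : ∀ n t → suc (suc t) ≤ n → UpShape n (suc t) (prodUp n (suc t)) →
                     UpShape n (suc (suc t)) (prodUp n (suc (suc t)))
  prodUp-shape-suc n t 2+t≤n shape = record
    { upper-rows  = prodUp-upper n (suc (suc t))
    ; middle-rows = middle
    ; last-row    = λ i i≡n k → trans (K-⊗-row-≢ n j U i (λ i≡j → ℕ.<⇒≢ j<n (trans (sym i≡j) i≡n)) k)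
                                      (last-row i i≡n k)
    }
    where
    open UpShape shape
    U : Matrix n
    U = prodUp n (suc t)
    j : ℕ
    j = n ∸ suc t
    j<n : j < n
    j<n = ℕ.∸-monoʳ-< (s≤s z≤n) (ℕ.<⇒≤ 2+t≤n)
    middle : ∀ i → n ∸ suc (suc t) < pos i → pos i < n → (K n j ⊗ U) i ≗ -_ ∘ e n (suc (pos i))
    middle i j-1<i i<n with pos i ℕ.≟ j
    ... | no  i≢j = λ k → trans (K-⊗-row-≢ n j U i i≢j k) (middle-rows i j<i i<n k)
      where
      j<i : j < pos i
      j<i = pred[m]<n∧n≢m⇒m<n (subst (_< pos i) (sym (ℕ.pred[m∸n]≡m∸[1+n] n (suc t))) j-1<i) i≢j
    ... | yes i≡j = λ k → begin
        (K n j ⊗ U) i k        ≡⟨ K-⊗-K-⊗-row-≡ n j (n ∸ t) (prodUp n t) i c i≡j c≡n∸t r-adjacent k ⟩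
        - prodUp n t c k       ≡⟨ cong -_ (prodUp-upper n t c (ℕ.≤-reflexive c≡n∸t) k) ⟩
        - Id n c k             ≡⟨ cong -_ (Id-row n c k) ⟩
        - e n (pos c) k        ≡⟨ cong (λ x → - e n (suc x) k) (toℕ-fromℕ< i<n) ⟩
        - e n (suc (pos i)) k  ∎
      where
      open ≡-Reasoning
      c : Fin n
      c = fromℕ< i<n
      n∸t≡1+j : n ∸ t ≡ suc j
      n∸t≡1+j = m∸n≡1+[m∸[1+n]] n t (subst (0 <_) i≡j (s≤s z≤n))
      c≡n∸t : pos c ≡ n ∸ t
      c≡n∸t = trans (cong suc (trans (toℕ-fromℕ< i<n) i≡j)) (sym n∸t≡1+j)
      r-adjacent : ∀ k → r n j k ≡ - r n (n ∸ t) k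
      r-adjacent k = trans (r-pred n j k) (cong (λ x → - r n x k) (sym n∸t≡1+j))

  prodUp-shape : ∀ n s → 1 ≤ s → s ≤ n → UpShape n s (prodUp n s)
  prodUp-shape (suc m) (suc zero) _ _ = record
    { upper-rows  = prodUp-upper (suc m) 1
    ; middle-rows = λ i m<i i<1+m → contradiction (ℕ.s≤s⁻¹ i<1+m) (ℕ.<⇒≱ m<i)
    ; last-row    = λ i i≡n k → trans (K-⊗-row-≡ (suc m) (suc m) (Id (suc m)) i i≡n k) (⊙-Id (r (suc m) (suc m)) k)
    }
  prodUp-shape n (suc (suc t)) _ 2+t≤n =
    prodUp-shape-suc n t 2+t≤n (prodUp-shape n (suc t) (s≤s z≤n) (ℕ.<⇒≤ 2+t≤n))

  ΣM-outer-miss : ∀ {n} b (φ : ℕ → ℕ) (v : ℕ → Fin n → ℤ) (i : Fin n) →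
                  (∀ j → 1 ≤ j → j ≤ b → φ j ≢ pos i) →
                  ΣM n 1 b (λ j → outer (e n (φ j)) (v j)) i ≗ λ _ → 0ℤ
  ΣM-outer-miss zero    φ v i miss k = refl
  ΣM-outer-miss (suc b) φ v i miss k =
    cong₂ _+_ (ΣM-outer-miss b φ v i (λ j 1≤j j≤b → miss j 1≤j (ℕ.m≤n⇒m≤1+n j≤b)) k)
              (cong (_* v (suc b) k) (δ-≢ (≢-sym (miss (suc b) (s≤s z≤n) ℕ.≤-refl))))

  ΣM-outer-hit : ∀ {n} b (φ : ℕ → ℕ) (v : ℕ → Fin n → ℤ) (i : Fin n) j₀ →
                 1 ≤ j₀ → j₀ ≤ b → φ j₀ ≡ pos i → (∀ j → 1 ≤ j → j ≤ b → φ j ≡ pos i → j ≡ j₀) →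
                 ΣM n 1 b (λ j → outer (e n (φ j)) (v j)) i ≗ v j₀
  ΣM-outer-hit zero    φ v i (suc j₀) _ () _ _
  ΣM-outer-hit {n} (suc b) φ v i j₀ 1≤j₀ j₀≤1+b hit unique k with j₀ ℕ.≟ suc b
  ... | yes refl = begin
    Σ + δ (pos i) (φ (suc b)) * v (suc b) k  ≡⟨ cong₂ _+_ (ΣM-outer-miss b φ v i miss k) (cong (_* v (suc b) k) φ[1+b]-hit) ⟩
    0ℤ + 1ℤ * v (suc b) k                    ≡⟨ trans (ℤ.+-identityˡ _) (ℤ.*-identityˡ _) ⟩
    v (suc b) k                              ∎
    where
    open ≡-Reasoning
    Σ : ℤ
    Σ = ΣM n 1 b (λ j → outer (e n (φ j)) (v j)) i k
    φ[1+b]-hit : δ (pos i) (φ (suc b)) ≡ 1ℤ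
    φ[1+b]-hit = trans (cong (δ (pos i)) hit) (δ-refl (pos i))
    miss : ∀ j → 1 ≤ j → j ≤ b → φ j ≢ pos i
    miss j 1≤j j≤b φj≡i = ℕ.<⇒≢ (s≤s j≤b) (unique j 1≤j (ℕ.m≤n⇒m≤1+n j≤b) φj≡i)
  ... | no j₀≢1+b = trans (cong₂ _+_ earlier (cong (_* v (suc b) k) φ[1+b]-miss)) (ℤ.+-identityʳ (v j₀ k))
    where
    earlier : ΣM n 1 b (λ j → outer (e n (φ j)) (v j)) i k ≡ v j₀ k
    earlier = ΣM-outer-hit b φ v i j₀ 1≤j₀ (ℕ.≤-pred (ℕ.≤∧≢⇒< j₀≤1+b j₀≢1+b)) hit
                           (λ j 1≤j j≤b → unique j 1≤j (ℕ.m≤n⇒m≤1+n j≤b)) k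
    φ[1+b]-miss : δ (pos i) (φ (suc b)) ≡ 0ℤ
    φ[1+b]-miss = δ-≢ λ i≡φ → j₀≢1+b (sym (unique (suc b) (s≤s z≤n) ℕ.≤-refl (sym i≡φ)))

  -- The j = 1 terms of both second sums of the statement vanish, as e n 0 and e n (n + 1) are zero
  -- vectors, so those sums can be analysed like the first sums, which start at j = 1.
  ΣM-from-2 : ∀ {n} b (F : ℕ → Matrix n) → F 1 ≐ Zero n → ΣM n 2 b F ≐ ΣM n 1 b F
  ΣM-from-2 zero          F F₁≐0 i k = refl
  ΣM-from-2 (suc zero)    F F₁≐0 i k = sym (trans (ℤ.+-identityˡ (F 1 i k)) (F₁≐0 i k))
  ΣM-from-2 (suc (suc b)) F F₁≐0 i k = cong (_+ F (suc (suc b)) i k) (ΣM-from-2 (suc b) F F₁≐0 i k)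

  ΣM-diagonal-hit : ∀ {n} s (v : ℕ → Fin n → ℤ) (i : Fin n) → pos i ≤ s →
                    ΣM n 1 s (λ j → outer (e n j) (v j)) i ≗ v (pos i)
  ΣM-diagonal-hit s v i i≤s = ΣM-outer-hit s (λ j → j) v i (pos i) (s≤s z≤n) i≤s refl (λ j _ _ j≡i → j≡i)

  ΣM-diagonal-miss : ∀ {n} s (v : ℕ → Fin n → ℤ) (i : Fin n) → s < pos i →
                     ΣM n 1 s (λ j → outer (e n j) (v j)) i ≗ λ _ → 0ℤ
  ΣM-diagonal-miss s v i s<i = ΣM-outer-miss s (λ j → j) v i (λ j _ j≤s → ℕ.<⇒≢ (ℕ.≤-<-trans j≤s s<i))

  ΣM-reflected-hit : ∀ {n} s (v : ℕ → Fin n → ℤ) (i : Fin n) → s ≤ n → n ∸ s < pos i →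
                     ΣM n 1 s (λ j → outer (e n (n ∸ j ℕ.+ 1)) (v j)) i ≗ v (n ∸ toℕ i)
  ΣM-reflected-hit {n} s v i s≤n n∸s<i =
    ΣM-outer-hit s (λ j → n ∸ j ℕ.+ 1) v i (n ∸ toℕ i) (ℕ.m<n⇒0<n∸m (toℕ<n i)) j₀≤s hit unique
    where
    j₀≤s : n ∸ toℕ i ≤ s
    j₀≤s = ℕ.≤-trans (ℕ.∸-monoʳ-≤ n (ℕ.s≤s⁻¹ n∸s<i)) (ℕ.≤-reflexive (ℕ.m∸[m∸n]≡n s≤n))
    hit : n ∸ (n ∸ toℕ i) ℕ.+ 1 ≡ pos i
    hit = trans (ℕ.+-comm _ 1) (cong suc (ℕ.m∸[m∸n]≡n (ℕ.<⇒≤ (toℕ<n i))))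
    unique : ∀ j → 1 ≤ j → j ≤ s → n ∸ j ℕ.+ 1 ≡ pos i → j ≡ n ∸ toℕ i
    unique j _ j≤s φj≡i = trans (sym (ℕ.m∸[m∸n]≡n (ℕ.≤-trans j≤s s≤n)))
                                (cong (n ∸_) (ℕ.suc-injective (trans (ℕ.+-comm 1 (n ∸ j)) φj≡i)))

  ΣM-reflected-miss : ∀ {n} s (v : ℕ → Fin n → ℤ) (i : Fin n) → pos i ≤ n ∸ s →
                      ΣM n 1 s (λ j → outer (e n (n ∸ j ℕ.+ 1)) (v j)) i ≗ λ _ → 0ℤ
  ΣM-reflected-miss {n} s v i i≤n∸s = ΣM-outer-miss s (λ j → n ∸ j ℕ.+ 1) v i miss
    where
    miss : ∀ j → 1 ≤ j → j ≤ s → n ∸ j ℕ.+ 1 ≢ pos i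
    miss j _ j≤s φj≡i = ℕ.<⇒≱ (ℕ.≤-reflexive (trans (ℕ.+-comm 1 (n ∸ j)) φj≡i))
                              (ℕ.≤-trans i≤n∸s (ℕ.∸-monoʳ-≤ n j≤s))

  module _ {n} (S₁ S₂ : Matrix n) (u w : Fin n → ℤ) (i : Fin n) where

    perturbed-row-miss : S₁ i ≗ (λ _ → 0ℤ) → S₂ i ≗ (λ _ → 0ℤ) → u i ≡ 0ℤ →
                         (((Id n ⊖ S₁) ⊖ S₂) ⊕ outer u w) i ≗ Id n i
    perturbed-row-miss S₁≗0 S₂≗0 u≡0 k = begin
      (Id n i k - S₁ i k) - S₂ i k + u i * w k  ≡⟨ cong₂ (λ a b → (Id n i k - a) - b + u i * w k) (S₁≗0 k) (S₂≗0 k) ⟩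
      (Id n i k - 0ℤ) - 0ℤ + u i * w k          ≡⟨ cong (λ d → (Id n i k - 0ℤ) - 0ℤ + d * w k) u≡0 ⟩
      (Id n i k - 0ℤ) - 0ℤ + 0ℤ * w k           ≡⟨ simplify (Id n i k) (w k) ⟩
      Id n i k                                  ∎
      where
      open ≡-Reasoning
      simplify : ∀ x z → (x - 0ℤ) - 0ℤ + 0ℤ * z ≡ x
      simplify = solve-∀

    perturbed-row-hit : (y : Fin n → ℤ) → S₁ i ≗ e n (pos i) → S₂ i ≗ y →
                        (((Id n ⊖ S₁) ⊖ S₂) ⊕ outer u w) i ≗ λ k → u i * w k - y k
    perturbed-row-hit y S₁≗e S₂≗y k = begin
      (Id n i k - S₁ i k) - S₂ i k + u i * w k  ≡⟨ cong₂ (λ a b → (Id n i k - a) - b + u i * w k) (S₁≗e k) (S₂≗y k) ⟩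
      (Id n i k - x) - y k + u i * w k          ≡⟨ cong (λ a → (a - x) - y k + u i * w k) (Id-row n i k) ⟩
      (x - x) - y k + u i * w k                 ≡⟨ simplify x (y k) (u i * w k) ⟩
      u i * w k - y k                           ∎
      where
      open ≡-Reasoning
      x : ℤ
      x = e n (pos i) k
      simplify : ∀ x y z → (x - x) - y + z ≡ z - y
      simplify = solve-∀

  downFormula : (n s : ℕ) → Matrix n
  downFormula n s = ((Id n ⊖ ΣM n 1 s (λ j → outer (e n j) (e n j)))
                      ⊖ ΣM n 2 s (λ j → outer (e n j) (e n (j ∸ 1))))
                    ⊕ outer (e n 1) (r n 1)

  downFormula-shape : ∀ n s → 1 ≤ s → DownShape n s (downFormula n s)
  downFormula-shape n s 1≤s = record
    { first-row   = λ i i≡1 k → begin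
        downFormula n s i k                        ≡⟨ active-row i (ℕ.≤-trans (ℕ.≤-reflexive i≡1) 1≤s) k ⟩
        δ (pos i) 1 * r n 1 k - e n (pos i ∸ 1) k  ≡⟨ cong (λ p → δ p 1 * r n 1 k - e n (p ∸ 1) k) i≡1 ⟩
        1ℤ * r n 1 k - 0ℤ                          ≡⟨ trans (ℤ.+-identityʳ _) (ℤ.*-identityˡ _) ⟩
        r n 1 k                                    ∎
    ; middle-rows = λ i 2≤i i≤s k → begin
        downFormula n s i k                        ≡⟨ active-row i i≤s k ⟩
        δ (pos i) 1 * r n 1 k - e n (pos i ∸ 1) k  ≡⟨ cong (λ d → d * r n 1 k - e n (pos i ∸ 1) k) (δ-≢ (ℕ.>⇒≢ 2≤i)) ⟩
        0ℤ - e n (pos i ∸ 1) k                     ≡⟨ ℤ.+-identityˡ _ ⟩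
        - e n (pos i ∸ 1) k                        ∎
    ; lower-rows  = λ i s<i → perturbed-row-miss S₁ S₂ (e n 1) (r n 1) i
        (ΣM-diagonal-miss s (e n) i s<i)
        (λ k → trans (ΣM-from-2 s F₂ F₂[1]≐0 i k) (ΣM-diagonal-miss s (λ j → e n (j ∸ 1)) i s<i k))
        (δ-≢ (ℕ.>⇒≢ (ℕ.≤-<-trans 1≤s s<i)))
    }
    where
    open ≡-Reasoning
    F₂ : ℕ → Matrix n
    F₂ j = outer (e n j) (e n (j ∸ 1))
    S₁ S₂ : Matrix n
    S₁ = ΣM n 1 s (λ j → outer (e n j) (e n j))
    S₂ = ΣM n 2 s F₂
    F₂[1]≐0 : F₂ 1 ≐ Zero n
    F₂[1]≐0 i k = ℤ.*-zeroʳ (e n 1 i)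
    active-row : ∀ i → pos i ≤ s → downFormula n s i ≗ λ k → δ (pos i) 1 * r n 1 k - e n (pos i ∸ 1) k
    active-row i i≤s = perturbed-row-hit S₁ S₂ (e n 1) (r n 1) i (e n (pos i ∸ 1))
      (ΣM-diagonal-hit s (e n) i i≤s)
      (λ k → trans (ΣM-from-2 s F₂ F₂[1]≐0 i k) (ΣM-diagonal-hit s (λ j → e n (j ∸ 1)) i i≤s k))

  upFormula : (n s : ℕ) → Matrix n
  upFormula n s = ((Id n ⊖ ΣM n 1 s (λ j → outer (e n (n ∸ j ℕ.+ 1)) (e n (n ∸ j ℕ.+ 1))))
                    ⊖ ΣM n 2 s (λ j → outer (e n (n ∸ j ℕ.+ 1)) (e n (n ∸ j ℕ.+ 2))))
                  ⊕ outer (e n n) (r n n)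

  upFormula-shape : ∀ n s → 1 ≤ s → s ≤ n → UpShape n s (upFormula n s)
  upFormula-shape n s 1≤s s≤n = record
    { upper-rows  = λ i i≤n∸s → perturbed-row-miss S₁ S₂ (e n n) (r n n) i
        (ΣM-reflected-miss s (λ j → e n (n ∸ j ℕ.+ 1)) i i≤n∸s)
        (λ k → trans (ΣM-from-2 s F₂ F₂[1]≐0 i k) (ΣM-reflected-miss s (λ j → e n (n ∸ j ℕ.+ 2)) i i≤n∸s k))
        (δ-≢ (ℕ.<⇒≢ (ℕ.≤-<-trans i≤n∸s n∸s<n)))
    ; middle-rows = λ i n∸s<i i<n k → begin
        upFormula n s i k                            ≡⟨ active-row i n∸s<i k ⟩
        δ (pos i) n * r n n k - e n (suc (pos i)) k  ≡⟨ cong (λ d → d * r n n k - e n (suc (pos i)) k) (δ-≢ (ℕ.<⇒≢ i<n)) ⟩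
        0ℤ - e n (suc (pos i)) k                     ≡⟨ ℤ.+-identityˡ _ ⟩
        - e n (suc (pos i)) k                        ∎
    ; last-row    = λ i i≡n k → begin
        upFormula n s i k                            ≡⟨ active-row i (subst (n ∸ s <_) (sym i≡n) n∸s<n) k ⟩
        δ (pos i) n * r n n k - e n (suc (pos i)) k  ≡⟨ cong (λ p → δ p n * r n n k - e n (suc p) k) i≡n ⟩
        δ n n * r n n k - e n (suc n) k              ≡⟨ cong₂ (λ d y → d * r n n k - y) (δ-refl n) (e-beyond n (suc n) ℕ.≤-refl k) ⟩
        1ℤ * r n n k - 0ℤ                            ≡⟨ trans (ℤ.+-identityʳ _) (ℤ.*-identityˡ _) ⟩
        r n n k                                      ∎
    }
    where
    open ≡-Reasoning
    n∸s<n : n ∸ s < n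
    n∸s<n = ℕ.∸-monoʳ-< 1≤s s≤n
    F₂ : ℕ → Matrix n
    F₂ j = outer (e n (n ∸ j ℕ.+ 1)) (e n (n ∸ j ℕ.+ 2))
    S₁ S₂ : Matrix n
    S₁ = ΣM n 1 s (λ j → outer (e n (n ∸ j ℕ.+ 1)) (e n (n ∸ j ℕ.+ 1)))
    S₂ = ΣM n 2 s F₂
    n<n∸1+2 : n < n ∸ 1 ℕ.+ 2
    n<n∸1+2 = ℕ.≤-trans (s≤s (ℕ.m≤n+m∸n n 1)) (ℕ.≤-reflexive (ℕ.+-comm 2 (n ∸ 1)))
    F₂[1]≐0 : F₂ 1 ≐ Zero n
    F₂[1]≐0 i k = trans (cong (e n (n ∸ 1 ℕ.+ 1) i *_) (e-beyond n (n ∸ 1 ℕ.+ 2) n<n∸1+2 k))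
                        (ℤ.*-zeroʳ (e n (n ∸ 1 ℕ.+ 1) i))
    reflect : ∀ (i : Fin n) c → n ∸ (n ∸ toℕ i) ℕ.+ c ≡ toℕ i ℕ.+ c
    reflect i c = cong (ℕ._+ c) (ℕ.m∸[m∸n]≡n (ℕ.<⇒≤ (toℕ<n i)))
    active-row : ∀ i → n ∸ s < pos i → upFormula n s i ≗ λ k → δ (pos i) n * r n n k - e n (suc (pos i)) k
    active-row i n∸s<i = perturbed-row-hit S₁ S₂ (e n n) (r n n) i (e n (suc (pos i)))
      (λ k → trans (ΣM-reflected-hit s (λ j → e n (n ∸ j ℕ.+ 1)) i s≤n n∸s<i k)
                   (cong (λ j → e n j k) (trans (reflect i 1) (ℕ.+-comm (toℕ i) 1))))
      (λ k → trans (ΣM-from-2 s F₂ F₂[1]≐0 i k)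
             (trans (ΣM-reflected-hit s (λ j → e n (n ∸ j ℕ.+ 2)) i s≤n n∸s<i k)
                    (cong (λ j → e n j k) (trans (reflect i 2) (ℕ.+-comm (toℕ i) 2)))))

open Rows
open import Data.Nat using (_+_)

lemma2p6 : (s n : ℕ) → 2 ≤ s → s ≤ n →
    (prodDown n s ≐
      (((Id n ⊖ ΣM n 1 s (λ j → outer (e n j) (e n j)))
          ⊖ ΣM n 2 s (λ j → outer (e n j) (e n (j ∸ 1))))
        ⊕ outer (e n 1) (r n 1)))
    ×
    (prodUp n s ≐
      (((Id n ⊖ ΣM n 1 s (λ j → outer (e n (n ∸ j + 1)) (e n (n ∸ j + 1))))
          ⊖ ΣM n 2 s (λ j → outer (e n (n ∸ j + 1)) (e n (n ∸ j + 2))))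
        ⊕ outer (e n n) (r n n)))
lemma2p6 s n 2≤s s≤n =
    DownShape-unique (prodDown-shape n s 1≤s s≤n) (downFormula-shape n s 1≤s)
  , UpShape-unique (prodUp-shape n s 1≤s s≤n) (upFormula-shape n s 1≤s s≤n)
  where
  1≤s : 1 ≤ s
  1≤s = ℕ.<⇒≤ 2≤s
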